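{- Let $(G,f,\pi)$ be a monotone SDS. (a) The set of fixed points of $(G,f,\pi)$, with the partial order inherited from $\mathbb{F}_2^n$, is a complete lattice $\mathbb{L}_\pi$. (b) Let MAX and MIN denote the maximum and minimum of $\mathbb{L}_\pi$. Then every periodic point $X$ of $(G,f,\pi)$ is comparable in $\mathbb{F}_2^n$ to MAX and to MIN, and $\mathrm{MIN}\le X\le\mathrm{MAX}$.
   Context: Let $G$ be a simple graph with vertex set $\{1,\dots,n\}$, each vertex having a state in $\mathbb{F}_2=\{0,1\}$; states are elements of $\mathbb{F}_2^n$. Each vertex $i$ has a local function $f_i$ of the states of $i$ and its neighbours; its inflation $F_i:\mathbb{F}_2^n\to\mathbb{F}_2^n$ replaces coordinate $i$ by this value and fixes other coordinates. For an update schedule (permutation) $\pi=\pi_1\cdots\pi_n$, $F_\pi=F_{\pi_n}\circ\cdots\circ F_{\pi_1}$; $(G,f,\pi)$ is an SDS. Order $\mathbb{F}_2^n$ componentwise with $0<1$; the SDS is monotone if each $f_i$ is monotone. A fixed point is $X$ with $F_\pi(X)=X$. A periodic point is a state $X$ with $F_\pi^k(X)=X$ for some $k\ge1$. -}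

module Defs where

open import Data.Nat using (ℕ; suc)
open import Data.Bool using (Bool; T) renaming (_≤_ to _≤𝔹_)
open import Data.Fin using (Fin)
open import Data.Vec using (Vec; lookup; _[_]≔_; allFin; toList)
open import Data.List using (List; []; _∷_; map)
open import Data.Vec.Relation.Binary.Pointwise.Inductive using (Pointwise)
open import Data.Fin.Permutation using (Permutation′; _⟨$⟩ʳ_)
open import Data.Product using (Σ; _×_; ∃)
open import Data.Sum using (_⊎_)
open import Relation.Binary.PropositionalEquality using (_≡_)
open import Relation.Nullary using (¬_)
open import Level using (0ℓ; suc) renaming (_⊔_ to _⊔ℓ_)

-- States: elements of 𝔽₂ⁿ, represented as vectors of booleans (false = 0, true = 1).
State : ℕ → Set
State n = Vec Bool n

_≤ₛ_ : ∀ {n} → State n → State n → Set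
_≤ₛ_ = Pointwise _≤𝔹_

record SimpleGraph (n : ℕ) : Set₁ where
  field
    Adj    : Fin n → Fin n → Set
    sym    : ∀ {i j} → Adj i j → Adj j i
    irrefl : ∀ {i} → ¬ Adj i i

record LocalFunctions {n : ℕ} (G : SimpleGraph n) : Set where
  open SimpleGraph G
  field
    fn    : Fin n → State n → Bool
    local : ∀ i (x y : State n) →
            (∀ j → (j ≡ i ⊎ Adj i j) → lookup x j ≡ lookup y j) →
            fn i x ≡ fn i y

open LocalFunctions public

Monotone : ∀ {n} {G : SimpleGraph n} → LocalFunctions G → Set
Monotone {n} f = ∀ i (x y : State n) → x ≤ₛ y → fn f i x ≤𝔹 fn f i y

inflation : ∀ {n} {G : SimpleGraph n} → LocalFunctions G → Fin n → State n → State n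
inflation f i x = x [ i ]≔ fn f i x

sweep : ∀ {n} → (Fin n → State n → State n) → List (Fin n) → State n → State n
sweep F []       x = x
sweep F (i ∷ is) x = sweep F is (F i x)

-- The SDS map F_π = F_{π_n} ∘ ⋯ ∘ F_{π_1}, where the update schedule is the
-- permutation π with π_k = π ⟨$⟩ʳ (k-1).
SDSmap : ∀ {n} {G : SimpleGraph n} → LocalFunctions G → Permutation′ n → State n → State n
SDSmap {n} f π = sweep (inflation f) (map (π ⟨$⟩ʳ_) (toList (allFin n)))

iterate : ∀ {A : Set} → (A → A) → ℕ → A → A
iterate F ℕ.zero    x = x
iterate F (ℕ.suc k) x = F (iterate F k x)

IsFixedPoint : ∀ {n} {G : SimpleGraph n} → LocalFunctions G → Permutation′ n → State n → Set
IsFixedPoint f π X = SDSmap f π X ≡ X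

IsPeriodicPoint : ∀ {n} {G : SimpleGraph n} → LocalFunctions G → Permutation′ n → State n → Set
IsPeriodicPoint f π X = ∃ λ k → iterate (SDSmap f π) (ℕ.suc k) X ≡ X

Subset : ℕ → Set
Subset n = State n → Bool

module _ {n : ℕ} (P : State n → Set) where
  IsUpperBound : Subset n → State n → Set
  IsUpperBound S u = ∀ x → T (S x) → x ≤ₛ u

  IsLowerBound : Subset n → State n → Set
  IsLowerBound S l = ∀ x → T (S x) → l ≤ₛ x

  IsSupremumIn : Subset n → State n → Set
  IsSupremumIn S s = P s × IsUpperBound S s ×
                     (∀ u → P u → IsUpperBound S u → s ≤ₛ u)

  IsInfimumIn : Subset n → State n → Set
  IsInfimumIn S m = P m × IsLowerBound S m ×
                    (∀ l → P l → IsLowerBound S l → l ≤ₛ m)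

  IsCompleteLattice : Set
  IsCompleteLattice = ∀ (S : Subset n) → (∀ x → T (S x) → P x) →
                      (∃ λ s → IsSupremumIn S s) × (∃ λ m → IsInfimumIn S m)

  IsMaximum : State n → Set
  IsMaximum M = P M × (∀ x → P x → x ≤ₛ M)

  IsMinimum : State n → Set
  IsMinimum m = P m × (∀ x → P x → m ≤ₛ x)

-- A monotone self-map F of the finite lattice 𝔹ⁿ pushes a post-fixed point up a chain
-- that must become stationary within n steps, since each strict step sets another bit;
-- dually it pushes a pre-fixed point down. Starting from the join of a set of fixed points
-- (a post-fixed point) this yields the least fixed point above the set, and dually the
-- greatest one below it. A periodic point X equals F^k X for all multiples k of its
-- period, and F^k X ≤ F^k ⊤, which is a fixed point once k > n; hence X ≤ MAX, and
-- dually MIN ≤ X.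
module Submission where

open import Defs
open import Data.Bool using (Bool; true; false; not; T; b≤b; f≤t) renaming (_≤_ to _≤𝔹_)
open import Data.Bool.Properties using ()
  renaming (≤-refl to ≤𝔹-refl; ≤-trans to ≤𝔹-trans; ≤-minimum to ≤𝔹-minimum; ≤-maximum to ≤𝔹-maximum)
open import Data.Empty using (⊥-elim)
open import Data.Fin using (Fin)
open import Data.Fin.Permutation using (Permutation′; _⟨$⟩ʳ_)
open import Data.List using ([]; _∷_; map)
open import Data.Nat using (ℕ; zero; suc; _+_; _*_; _<_; z≤n; s≤s) renaming (_≤_ to _≤ℕ_)
open import Data.Nat.Properties using (<⇒≤; ≤-<-trans; ≤-trans; ≤-refl; ≤-reflexive; <⇒≱; m≤m*n)
open import Data.Product using (_×_; _,_; ∃)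
open import Data.Sum using (_⊎_; inj₁; inj₂; [_,_]′)
import Data.Sum as Sum
open import Data.Vec using ([]; _∷_; lookup; tabulate; replicate; countᵇ; _[_]≔_; toList; allFin)
open import Data.Vec.Properties using (tabulate∘lookup; count≤n)
open import Data.Vec.Relation.Binary.Pointwise.Inductive using ([]; _∷_)
import Data.Vec.Relation.Binary.Pointwise.Inductive as Pointwise
open import Function using (_∘_; id)
open import Relation.Binary.PropositionalEquality using (_≡_; refl; sym; trans; cong; subst)
open import Relation.Nullary using (¬_; Dec; isYes; isNo; T?; ¬?; _×-dec_; _⊎-dec_)
open import Relation.Nullary.Decidable
  using (map′; decidable-stable; toWitness; fromWitness; toWitnessFalse; fromWitnessFalse)

private
  variable
    n : ℕ
    x y z : State n

iterate-+ : ∀ {A : Set} (F : A → A) j k (x : A) → iterate F (j + k) x ≡ iterate F j (iterate F k x)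
iterate-+ F zero    k x = refl
iterate-+ F (suc j) k x = cong F (iterate-+ F j k x)

iterate-periodic : ∀ {A : Set} (F : A → A) {x : A} p → iterate F (suc p) x ≡ x →
                   ∀ m → iterate F (m * suc p) x ≡ x
iterate-periodic F p periodic zero    = refl
iterate-periodic F {x} p periodic (suc m) =
  trans (iterate-+ F (suc p) (m * suc p) x)
        (trans (cong (iterate F (suc p)) (iterate-periodic F p periodic m)) periodic)

iterate-fixed : ∀ {A : Set} (F : A → A) {x : A} → F x ≡ x → ∀ k → iterate F k x ≡ x
iterate-fixed F fx zero    = refl
iterate-fixed F fx (suc k) = trans (cong F (iterate-fixed F fx k)) fx

iterate-fixed-beyond : ∀ {A : Set} (F : A → A) (h : A → ℕ) {b} (x : A) →
  (∀ y → h y ≤ℕ b) →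
  (∀ k → iterate F k x ≡ iterate F (suc k) x ⊎ h (iterate F k x) < h (iterate F (suc k) x)) →
  ∀ {k} → b < k → F (iterate F k x) ≡ iterate F k x
iterate-fixed-beyond F h {b} x bounded ascent {k} b<k =
  [ id , (λ k≤h → ⊥-elim (<⇒≱ b<k (≤-trans k≤h (bounded _)))) ]′ (fixed-or-high k)
  where
  fixed-or-high : ∀ k → F (iterate F k x) ≡ iterate F k x ⊎ k ≤ℕ h (iterate F k x)
  fixed-or-high zero = inj₂ z≤n
  fixed-or-high (suc k) with fixed-or-high k | ascent k
  ... | inj₁ fixed | _          = inj₁ (cong F fixed)
  ... | inj₂ _     | inj₁ same  = inj₁ (cong F (sym same))
  ... | inj₂ k≤h   | inj₂ h<h′  = inj₂ (≤-<-trans k≤h h<h′)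

≤ₛ-refl : x ≤ₛ x
≤ₛ-refl = Pointwise.refl ≤𝔹-refl

≤ₛ-trans : x ≤ₛ y → y ≤ₛ z → x ≤ₛ z
≤ₛ-trans = Pointwise.trans ≤𝔹-trans

T-mono : ∀ {a b} → a ≤𝔹 b → T a → T b
T-mono b≤b t = t

≤𝔹-from-T : ∀ {a b} → (T a → T b) → a ≤𝔹 b
≤𝔹-from-T {false} _ = ≤𝔹-minimum _
≤𝔹-from-T {true} {true}  _ = b≤b
≤𝔹-from-T {true} {false} h = ⊥-elim (h _)

≤ₛ-tabulateʳ : ∀ {g : Fin n → Bool} → (∀ i → T (lookup x i) → T (g i)) → x ≤ₛ tabulate g
≤ₛ-tabulateʳ {x = x} le =
  subst (_≤ₛ _) (tabulate∘lookup x) (Pointwise.tabulate⁺ (≤𝔹-from-T ∘ le))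

≤ₛ-tabulateˡ : ∀ {f : Fin n → Bool} → (∀ i → T (f i) → T (lookup y i)) → tabulate f ≤ₛ y
≤ₛ-tabulateˡ {y = y} le =
  subst (_ ≤ₛ_) (tabulate∘lookup y) (Pointwise.tabulate⁺ (≤𝔹-from-T ∘ le))

≤ₛ-bottom : replicate n false ≤ₛ x
≤ₛ-bottom {x = []}    = []
≤ₛ-bottom {x = a ∷ x} = ≤𝔹-minimum a ∷ ≤ₛ-bottom

≤ₛ-top : x ≤ₛ replicate n true
≤ₛ-top {x = []}    = []
≤ₛ-top {x = a ∷ x} = ≤𝔹-maximum a ∷ ≤ₛ-top

ones zeros : State n → ℕ
ones  = countᵇ id
zeros = countᵇ not

≤ₛ⇒≡⊎ones< : x ≤ₛ y → x ≡ y ⊎ ones x < ones y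
≤ₛ⇒≡⊎ones< []                  = inj₁ refl
≤ₛ⇒≡⊎ones< (f≤t ∷ x≤y)         =
  inj₂ (s≤s ([ ≤-reflexive ∘ cong ones , <⇒≤ ]′ (≤ₛ⇒≡⊎ones< x≤y)))
≤ₛ⇒≡⊎ones< (b≤b {true} ∷ x≤y)  = Sum.map (cong (true ∷_)) s≤s (≤ₛ⇒≡⊎ones< x≤y)
≤ₛ⇒≡⊎ones< (b≤b {false} ∷ x≤y) = Sum.map (cong (false ∷_)) id (≤ₛ⇒≡⊎ones< x≤y)

≤ₛ⇒≡⊎zeros> : x ≤ₛ y → x ≡ y ⊎ zeros y < zeros x
≤ₛ⇒≡⊎zeros> []                  = inj₁ refl
≤ₛ⇒≡⊎zeros> (f≤t ∷ x≤y)         =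
  inj₂ (s≤s ([ ≤-reflexive ∘ cong zeros ∘ sym , <⇒≤ ]′ (≤ₛ⇒≡⊎zeros> x≤y)))
≤ₛ⇒≡⊎zeros> (b≤b {true} ∷ x≤y)  = Sum.map (cong (true ∷_)) id (≤ₛ⇒≡⊎zeros> x≤y)
≤ₛ⇒≡⊎zeros> (b≤b {false} ∷ x≤y) = Sum.map (cong (false ∷_)) s≤s (≤ₛ⇒≡⊎zeros> x≤y)

∃? : {P : State n → Set} → (∀ x → Dec (P x)) → Dec (∃ P)
∃? {zero}  P? = map′ ([] ,_) (λ { ([] , p) → p }) (P? [])
∃? {suc n} P? = map′ [ cons false , cons true ]′ split
                     (∃? (P? ∘ (false ∷_)) ⊎-dec ∃? (P? ∘ (true ∷_)))
  where
  cons : ∀ {P} b → ∃ (P ∘ (b ∷_)) → ∃ P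
  cons b (x , p) = b ∷ x , p
  split : ∀ {P} → ∃ P → ∃ (P ∘ (false ∷_)) ⊎ ∃ (P ∘ (true ∷_))
  split (false ∷ x , p) = inj₁ (x , p)
  split (true  ∷ x , p) = inj₂ (x , p)

some-set? : (S : Subset n) (i : Fin n) → Dec (∃ λ x → T (S x) × T (lookup x i))
some-set? S i = ∃? λ x → T? (S x) ×-dec T? (lookup x i)

some-unset? : (S : Subset n) (i : Fin n) → Dec (∃ λ x → T (S x) × ¬ T (lookup x i))
some-unset? S i = ∃? λ x → T? (S x) ×-dec ¬? (T? (lookup x i))

join meet : Subset n → State n
join S = tabulate (isYes ∘ some-set? S)
meet S = tabulate (isNo ∘ some-unset? S)

module _ (S : Subset n) where

  join-upper : ∀ x → T (S x) → x ≤ₛ join S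
  join-upper x x∈S = ≤ₛ-tabulateʳ λ i t → fromWitness {a? = some-set? S i} (x , x∈S , t)

  join-least : ∀ u → (∀ x → T (S x) → x ≤ₛ u) → join S ≤ₛ u
  join-least u upper = ≤ₛ-tabulateˡ λ i w →
    let (x , x∈S , t) = toWitness {a? = some-set? S i} w
    in T-mono (Pointwise.lookup (upper x x∈S) i) t

  meet-lower : ∀ x → T (S x) → meet S ≤ₛ x
  meet-lower x x∈S = ≤ₛ-tabulateˡ λ i w →
    decidable-stable (T? (lookup x i)) λ ¬t → toWitnessFalse {a? = some-unset? S i} w (x , x∈S , ¬t)

  meet-greatest : ∀ l → (∀ x → T (S x) → l ≤ₛ x) → l ≤ₛ meet S
  meet-greatest l lower = ≤ₛ-tabulateʳ λ i t →
    fromWitnessFalse {a? = some-unset? S i} λ (x , x∈S , ¬t) →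
      ¬t (T-mono (Pointwise.lookup (lower x x∈S) i) t)

module MonotoneMap (F : State n → State n) (F-mono : ∀ {x y} → x ≤ₛ y → F x ≤ₛ F y) where

  Fixed : State n → Set
  Fixed x = F x ≡ x

  iterate-mono : ∀ k → x ≤ₛ y → iterate F k x ≤ₛ iterate F k y
  iterate-mono zero    x≤y = x≤y
  iterate-mono (suc k) x≤y = F-mono (iterate-mono k x≤y)

  postfixed-ascending : x ≤ₛ F x → ∀ k → iterate F k x ≤ₛ iterate F (suc k) x
  postfixed-ascending x≤Fx zero    = x≤Fx
  postfixed-ascending x≤Fx (suc k) = F-mono (postfixed-ascending x≤Fx k)

  prefixed-descending : F x ≤ₛ x → ∀ k → iterate F (suc k) x ≤ₛ iterate F k x
  prefixed-descending Fx≤x zero    = Fx≤x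
  prefixed-descending Fx≤x (suc k) = F-mono (prefixed-descending Fx≤x k)

  postfixed-≤-iterate : x ≤ₛ F x → ∀ k → x ≤ₛ iterate F k x
  postfixed-≤-iterate x≤Fx zero    = ≤ₛ-refl
  postfixed-≤-iterate x≤Fx (suc k) =
    ≤ₛ-trans (postfixed-≤-iterate x≤Fx k) (postfixed-ascending x≤Fx k)

  prefixed-iterate-≤ : F x ≤ₛ x → ∀ k → iterate F k x ≤ₛ x
  prefixed-iterate-≤ Fx≤x zero    = ≤ₛ-refl
  prefixed-iterate-≤ Fx≤x (suc k) =
    ≤ₛ-trans (prefixed-descending Fx≤x k) (prefixed-iterate-≤ Fx≤x k)

  postfixed-stabilises : x ≤ₛ F x → ∀ {k} → n < k → Fixed (iterate F k x)
  postfixed-stabilises x≤Fx = iterate-fixed-beyond F ones _ (count≤n (T? ∘ id))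
    (≤ₛ⇒≡⊎ones< ∘ postfixed-ascending x≤Fx)

  prefixed-stabilises : F x ≤ₛ x → ∀ {k} → n < k → Fixed (iterate F k x)
  prefixed-stabilises Fx≤x = iterate-fixed-beyond F zeros _ (count≤n (T? ∘ not))
    (Sum.map sym id ∘ ≤ₛ⇒≡⊎zeros> ∘ prefixed-descending Fx≤x)

  least-fixed-above : x ≤ₛ F x →
    ∃ λ s → Fixed s × x ≤ₛ s × (∀ v → Fixed v → x ≤ₛ v → s ≤ₛ v)
  least-fixed-above {x = x} x≤Fx =
      iterate F (suc n) x
    , postfixed-stabilises x≤Fx ≤-refl
    , postfixed-≤-iterate x≤Fx (suc n)
    , λ v fixed-v x≤v →
        subst (iterate F (suc n) x ≤ₛ_) (iterate-fixed F fixed-v (suc n)) (iterate-mono (suc n) x≤v)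

  greatest-fixed-below : F x ≤ₛ x →
    ∃ λ s → Fixed s × s ≤ₛ x × (∀ v → Fixed v → v ≤ₛ x → v ≤ₛ s)
  greatest-fixed-below {x = x} Fx≤x =
      iterate F (suc n) x
    , prefixed-stabilises Fx≤x ≤-refl
    , prefixed-iterate-≤ Fx≤x (suc n)
    , λ v fixed-v v≤x →
        subst (_≤ₛ iterate F (suc n) x) (iterate-fixed F fixed-v (suc n)) (iterate-mono (suc n) v≤x)

  fixed-complete : IsCompleteLattice Fixed
  fixed-complete S S⊆Fixed = sup , inf
    where
    join-postfixed : join S ≤ₛ F (join S)
    join-postfixed = join-least S _ λ x x∈S →
      subst (_≤ₛ F (join S)) (S⊆Fixed x x∈S) (F-mono (join-upper S x x∈S))

    meet-prefixed : F (meet S) ≤ₛ meet S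
    meet-prefixed = meet-greatest S _ λ x x∈S →
      subst (F (meet S) ≤ₛ_) (S⊆Fixed x x∈S) (F-mono (meet-lower S x x∈S))

    sup : ∃ (IsSupremumIn Fixed S)
    sup with least-fixed-above join-postfixed
    ... | s , fixed , join≤s , least =
      s , fixed , (λ x x∈S → ≤ₛ-trans (join-upper S x x∈S) join≤s)
        , λ u fixed-u upper → least u fixed-u (join-least S u upper)

    inf : ∃ (IsInfimumIn Fixed S)
    inf with greatest-fixed-below meet-prefixed
    ... | s , fixed , s≤meet , greatest =
      s , fixed , (λ x x∈S → ≤ₛ-trans s≤meet (meet-lower S x x∈S))
        , λ l fixed-l lower → greatest l fixed-l (meet-greatest S l lower)

  periodic-below-fixed : ∀ p → iterate F (suc p) x ≡ x → ∃ λ z → Fixed z × x ≤ₛ z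
  periodic-below-fixed {x = x} p periodic =
      iterate F j (replicate n true)
    , prefixed-stabilises ≤ₛ-top (m≤m*n (suc n) (suc p))
    , subst (_≤ₛ iterate F j (replicate n true)) (iterate-periodic F p periodic (suc n))
            (iterate-mono j ≤ₛ-top)
    where j = suc n * suc p

  periodic-above-fixed : ∀ p → iterate F (suc p) x ≡ x → ∃ λ z → Fixed z × z ≤ₛ x
  periodic-above-fixed {x = x} p periodic =
      iterate F j (replicate n false)
    , postfixed-stabilises ≤ₛ-bottom (m≤m*n (suc n) (suc p))
    , subst (iterate F j (replicate n false) ≤ₛ_) (iterate-periodic F p periodic (suc n))
            (iterate-mono j ≤ₛ-bottom)
    where j = suc n * suc p

  periodic-between-extremes : ∀ {MAX MIN} → IsMaximum Fixed MAX → IsMinimum Fixed MIN →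
    ∀ p → iterate F (suc p) x ≡ x → MIN ≤ₛ x × x ≤ₛ MAX
  periodic-between-extremes (_ , maximal) (_ , minimal) p periodic
    with periodic-above-fixed p periodic | periodic-below-fixed p periodic
  ... | z , fixed-z , z≤x | z′ , fixed-z′ , x≤z′ =
    ≤ₛ-trans (minimal z fixed-z) z≤x , ≤ₛ-trans x≤z′ (maximal z′ fixed-z′)

[]≔-mono : ∀ (i : Fin n) {a b} → x ≤ₛ y → a ≤𝔹 b → (x [ i ]≔ a) ≤ₛ (y [ i ]≔ b)
[]≔-mono Fin.zero    (_ ∷ x≤y) a≤b = a≤b ∷ x≤y
[]≔-mono (Fin.suc i) (c ∷ x≤y) a≤b = c ∷ []≔-mono i x≤y a≤b

sweep-mono : ∀ (F : Fin n → State n → State n) →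
             (∀ i {x y} → x ≤ₛ y → F i x ≤ₛ F i y) →
             ∀ is → x ≤ₛ y → sweep F is x ≤ₛ sweep F is y
sweep-mono F F-mono []       x≤y = x≤y
sweep-mono F F-mono (i ∷ is) x≤y = sweep-mono F F-mono is (F-mono i x≤y)

SDSmap-mono : ∀ {n} {G : SimpleGraph n} (f : LocalFunctions G) (π : Permutation′ n) →
              Monotone f → ∀ {x y} → x ≤ₛ y → SDSmap f π x ≤ₛ SDSmap f π y
SDSmap-mono {n} f π f-mono =
  sweep-mono (inflation f) (λ i x≤y → []≔-mono i x≤y (f-mono i _ _ x≤y))
             (map (π ⟨$⟩ʳ_) (toList (allFin n)))

proposition3p4 : ∀ (n : ℕ) (G : SimpleGraph n) (f : LocalFunctions G) (π : Permutation′ n) →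
    Monotone f →
    IsCompleteLattice (IsFixedPoint f π) ×
    (∀ MAX MIN → IsMaximum (IsFixedPoint f π) MAX → IsMinimum (IsFixedPoint f π) MIN →
      ∀ X → IsPeriodicPoint f π X → (MIN ≤ₛ X) × (X ≤ₛ MAX))
proposition3p4 n G f π f-mono =
    fixed-complete
  , λ MAX MIN max min X (p , periodic) → periodic-between-extremes max min p periodic
  where open MonotoneMap (SDSmap f π) (SDSmap-mono f π f-mono)
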